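{- Let $g_3(n)=\alpha_1n+\alpha_0$, $g_2(n)=\beta_1n+\beta_0$, $g_1(n)=\gamma_1n+\gamma_0$ be rational polynomials of degree at most $1$, none identically zero, none vanishing at any integer $n\ge 0$, with $g_3(n)>0$, $g_2(n)<0$, $g_1(n)>0$ for all integers $n\ge0$ (signature $(-,+)$). Let $b_n=g_2(n)/g_3(n)$, $a_n=g_1(n)/g_3(n)$, and let $f_n$ be the $n$th convergent of $\mathrm{K}_{n=1}^\infty(a_n/b_n)$. Let $(u_n)_{n\ge-1}$ be a solution of $g_3(n)u_n=g_2(n)u_{n-1}+g_1(n)u_{n-2}$ $(n\ge1)$ with $u_{ -1}>0$. Then for even $n\in\mathbb{N}$, $u_n>0$ if and only if $f_n>-u_0/u_{ -1}$; and for odd $n\in\mathbb{N}$, $u_n>0$ if and only if $f_n<-u_0/u_{ -1}$.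
   Context: The convergents are $f_n=\cfrac{a_1}{b_1+\cfrac{a_2}{\ddots+\cfrac{a_n}{b_n}}}=A_n/B_n$, where $(A_n),(B_n)$ solve $x_n=b_nx_{n-1}+a_nx_{n-2}$ with $A_{ -1}=1,A_0=0,B_{ -1}=0,B_0=1$. $\mathbb{N}=\{1,2,\dots\}$. -}

module Defs where

open import Data.Nat using (ℕ; zero; suc) renaming (_+_ to _+ℕ_)
open import Data.Integer using (+_)
open import Data.Rational using (ℚ; 0ℚ; _+_; _*_; _÷_; _/_; ≢-nonZero)
open import Data.Rational.Properties using (_≟_)
open import Data.Product using (_×_; _,_; proj₁; proj₂; ∃-syntax)
open import Relation.Nullary using (yes; no)
open import Relation.Binary.PropositionalEquality using (_≡_)

ℕtoℚ : ℕ → ℚ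
ℕtoℚ n = (+ n) / 1

-- total division on ℚ (p / 0 := 0); only ever applied to nonzero divisors
-- in the statement (B_n ≠ 0 and u(-1) > 0 under the hypotheses)
_÷₀_ : ℚ → ℚ → ℚ
p ÷₀ q with q ≟ 0ℚ
... | yes _ = 0ℚ
... | no q≢0 = _÷_ p q {{≢-nonZero q≢0}}

lin : ℚ → ℚ → ℕ → ℚ
lin c₁ c₀ n = c₁ * ℕtoℚ n + c₀

-- pairs (x(n-1), x_n) of the solution of x_n = b_n x(n-1) + a_n x(n-2)
-- with given x(-1), x_0
recPair : (a b : ℕ → ℚ) → ℚ → ℚ → ℕ → ℚ × ℚ
recPair a b xm1 x0 zero = xm1 , x0
recPair a b xm1 x0 (suc n) with recPair a b xm1 x0 n
... | p , q = q , (b (suc n) * q + a (suc n) * p)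

numA : (a b : ℕ → ℚ) → ℕ → ℚ
numA a b n = proj₂ (recPair a b 1ℚ' 0ℚ n)
  where 1ℚ' = (+ 1) / 1

denB : (a b : ℕ → ℚ) → ℕ → ℚ
denB a b n = proj₂ (recPair a b 0ℚ ((+ 1) / 1) n)

convergent : (a b : ℕ → ℚ) → ℕ → ℚ
convergent a b n = numA a b n ÷₀ denB a b n

Even : ℕ → Set
Even n = ∃[ k ] n ≡ k +ℕ k

Odd : ℕ → Set
Odd n = ∃[ k ] n ≡ suc (k +ℕ k)

module Submission where

-- Dividing the recurrence by g₃ turns it into
-- u_n = b_n u_{n-1} + a_n u_{n-2} with a_n > 0 > b_n, the recurrence of the
-- continued fraction itself.  Its solutions form a two-dimensional space
-- spanned by (A_n) and (B_n), so u_n = u_{-1} A_n + u_0 B_n.  Writing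
-- A_n = f_n B_n and c = -u_0/u_{-1} this becomes
--     u_n = (u_{-1} B_n) (f_n - c).
-- Since b_n < 0 ≤ a_n, the denominators alternate in sign: B_n > 0 for even n
-- and B_n < 0 for odd n.  With u_{-1} > 0 the sign of u_n is therefore the
-- sign of f_n - c for even n and the opposite sign for odd n.

open import Defs
open import Data.Nat using (ℕ; suc; zero) renaming (_+_ to _+ℕ_)
open import Data.Nat.Properties using (+-suc)
open import Data.Rational
  using (ℚ; 0ℚ; 1ℚ; _+_; _*_; -_; _-_; _<_; _≤_; 1/_; ≢-nonZero; positive; negative; nonNegative)
open import Data.Rational.Properties
open import Data.Rational.Solver using (module +-*-Solver)
open import Data.Product using (_×_; _,_; proj₁; proj₂)
open import Data.Empty using (⊥-elim)
open import Relation.Nullary using (¬_; yes; no)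
open import Relation.Binary.PropositionalEquality
open import Function.Bundles using (_⇔_; mk⇔)
open import Function.Construct.Composition using (_⇔-∘_)

open +-*-Solver

÷₀-*-inverse : ∀ p q → q ≢ 0ℚ → (p ÷₀ q) * q ≡ p
÷₀-*-inverse p q q≢0 with q ≟ 0ℚ
... | yes q≡0 = ⊥-elim (q≢0 q≡0)
... | no q≢0' = begin
    p * (1/ q) * q   ≡⟨ *-assoc p _ q ⟩
    p * ((1/ q) * q) ≡⟨ cong (p *_) (*-inverseˡ q) ⟩
    p * 1ℚ           ≡⟨ *-identityʳ p ⟩
    p                ∎
  where
  open ≡-Reasoning
  instance _ = ≢-nonZero q≢0'

*-÷₀-inverse : ∀ p q → q ≢ 0ℚ → (p * q) ÷₀ q ≡ p
*-÷₀-inverse p q q≢0 with q ≟ 0ℚ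
... | yes q≡0 = ⊥-elim (q≢0 q≡0)
... | no q≢0' = begin
    p * q * (1/ q)   ≡⟨ *-assoc p q _ ⟩
    p * (q * (1/ q)) ≡⟨ cong (p *_) (*-inverseʳ q) ⟩
    p * 1ℚ           ≡⟨ *-identityʳ p ⟩
    p                ∎
  where
  open ≡-Reasoning
  instance _ = ≢-nonZero q≢0'

*-cancelʳ-nonZero : ∀ x y g → g ≢ 0ℚ → x * g ≡ y * g → x ≡ y
*-cancelʳ-nonZero x y g g≢0 xg≡yg = begin
  x             ≡⟨ sym (*-÷₀-inverse x g g≢0) ⟩
  (x * g) ÷₀ g  ≡⟨ cong (_÷₀ g) xg≡yg ⟩
  (y * g) ÷₀ g  ≡⟨ *-÷₀-inverse y g g≢0 ⟩
  y             ∎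
  where open ≡-Reasoning

÷₀-pos : ∀ p q → 0ℚ < p → 0ℚ < q → 0ℚ < p ÷₀ q
÷₀-pos p q 0<p 0<q with q ≟ 0ℚ
... | yes q≡0 = ⊥-elim (<⇒≢ 0<q (sym q≡0))
... | no _ = positive⁻¹ _ {{pos*pos⇒pos p {{positive 0<p}} _ {{1/pos⇒pos q {{positive 0<q}}}}}}

÷₀-neg : ∀ p q → p < 0ℚ → 0ℚ < q → p ÷₀ q < 0ℚ
÷₀-neg p q p<0 0<q with q ≟ 0ℚ
... | yes q≡0 = ⊥-elim (<⇒≢ 0<q (sym q≡0))
... | no _ = negative⁻¹ _ {{neg*pos⇒neg p {{negative p<0}} _ {{1/pos⇒pos q {{positive 0<q}}}}}}

0<y-x⇔x<y : ∀ x y → 0ℚ < y - x ⇔ x < y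
0<y-x⇔x<y x y = mk⇔ from to
  where
  to : x < y → 0ℚ < y - x
  to x<y = subst (_< y - x) (+-inverseʳ x) (+-monoˡ-< (- x) x<y)
  from : 0ℚ < y - x → x < y
  from 0<y-x = subst₂ _<_ (+-identityˡ x) (solve 2 (λ y x → y :- x :+ x := y) refl y x)
                 (+-monoˡ-< x 0<y-x)

0<d*[y-x]⇔x<y : ∀ d x y → 0ℚ < d → 0ℚ < d * (y - x) ⇔ x < y
0<d*[y-x]⇔x<y d x y 0<d = 0<y-x⇔x<y x y ⇔-∘ scale
  where
  instance
    d-pos = positive 0<d
    d-nonNeg = pos⇒nonNeg d
  scale : 0ℚ < d * (y - x) ⇔ 0ℚ < y - x
  scale = mk⇔ (λ 0<dt → *-cancelˡ-<-nonNeg d (subst (_< d * (y - x)) (sym (*-zeroʳ d)) 0<dt))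
              (λ 0<t → subst (_< d * (y - x)) (*-zeroʳ d) (*-monoʳ-<-pos d 0<t))

0<d*[y-x]⇔y<x : ∀ d x y → d < 0ℚ → 0ℚ < d * (y - x) ⇔ y < x
0<d*[y-x]⇔y<x d x y d<0 =
  subst (λ t → 0ℚ < t ⇔ y < x) flip (0<d*[y-x]⇔x<y (- d) y x (neg-antimono-< d<0))
  where
  flip : (- d) * (x - y) ≡ d * (y - x)
  flip = solve 3 (λ d x y → (:- d) :* (x :- y) := d :* (y :- x)) refl d x y

step-neg : ∀ {a b x y} → b < 0ℚ → 0ℚ ≤ a → 0ℚ < y → x ≤ 0ℚ → b * y + a * x < 0ℚ
step-neg {a} {b} {x} {y} b<0 0≤a 0<y x≤0 = subst (b * y + a * x <_) (+-identityʳ 0ℚ)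
  (+-mono-<-≤ (negative⁻¹ (b * y) {{neg*pos⇒neg b {{negative b<0}} y {{positive 0<y}}}})
              (subst (a * x ≤_) (*-zeroʳ a) (*-monoˡ-≤-nonNeg a {{nonNegative 0≤a}} x≤0)))

step-pos : ∀ {a b x y} → b < 0ℚ → 0ℚ ≤ a → y < 0ℚ → 0ℚ ≤ x → 0ℚ < b * y + a * x
step-pos {a} {b} {x} {y} b<0 0≤a y<0 0≤x = subst (_< b * y + a * x) (+-identityʳ 0ℚ)
  (+-mono-<-≤ (positive⁻¹ (b * y) {{neg*neg⇒pos b {{negative b<0}} y {{negative y<0}}}})
              (subst (_≤ a * x) (*-zeroʳ a) (*-monoˡ-≤-nonNeg a {{nonNegative 0≤a}} 0≤x)))

normalise-recurrence : ∀ g₃ g₂ g₁ x y z → g₃ ≢ 0ℚ → g₃ * z ≡ g₂ * y + g₁ * x →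
                       z ≡ (g₂ ÷₀ g₃) * y + (g₁ ÷₀ g₃) * x
normalise-recurrence g₃ g₂ g₁ x y z g₃≢0 eq = *-cancelʳ-nonZero z _ g₃ g₃≢0 (begin
  z * g₃                                    ≡⟨ *-comm z g₃ ⟩
  g₃ * z                                    ≡⟨ eq ⟩
  g₂ * y + g₁ * x                           ≡⟨ cong₂ (λ s t → s * y + t * x)
                                                 (sym (÷₀-*-inverse g₂ g₃ g₃≢0))
                                                 (sym (÷₀-*-inverse g₁ g₃ g₃≢0)) ⟩
  (g₂ ÷₀ g₃) * g₃ * y + (g₁ ÷₀ g₃) * g₃ * x ≡⟨ solve 5 (λ p r g y x →
                                                   p :* g :* y :+ r :* g :* x := (p :* y :+ r :* x) :* g)
                                                 refl (g₂ ÷₀ g₃) (g₁ ÷₀ g₃) g₃ y x ⟩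
  ((g₂ ÷₀ g₃) * y + (g₁ ÷₀ g₃) * x) * g₃    ∎)
  where open ≡-Reasoning

module ContinuedFraction (a b : ℕ → ℚ) where

  -- U : ℕ → ℚ encodes (u_n)_{n ≥ -1} by U k = u_{k-1}.
  Solution : (ℕ → ℚ) → Set
  Solution U = ∀ m → U (suc (suc m)) ≡ b (suc m) * U (suc m) + a (suc m) * U m

  numPair denPair : ℕ → ℚ × ℚ
  numPair = recPair a b 1ℚ 0ℚ
  denPair = recPair a b 0ℚ 1ℚ

  superposition : ∀ U → Solution U → ∀ n → U (suc n) ≡ U 0 * numA a b n + U 1 * denB a b n
  superposition U sol n = proj₂ (pairs n)
    where
    combination : ℕ → (ℚ × ℚ → ℚ) → ℚ
    combination m π = U 0 * π (numPair m) + U 1 * π (denPair m)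

    pairs : ∀ n → U n ≡ combination n proj₁ × U (suc n) ≡ combination n proj₂
    pairs zero = solve 2 (λ u v → u := u :* con 1ℚ :+ v :* con 0ℚ) refl (U 0) (U 1)
               , solve 2 (λ u v → v := u :* con 0ℚ :+ v :* con 1ℚ) refl (U 0) (U 1)
    pairs (suc n) with pairs n
    ... | prev , curr = curr , (begin
        U (suc (suc n))                          ≡⟨ sol n ⟩
        β * U (suc n) + α * U n                   ≡⟨ cong₂ (λ s t → β * s + α * t) curr prev ⟩
        β * (u * A₂ + v * B₂) + α * (u * A₁ + v * B₁)
          ≡⟨ solve 8 (λ β α u v A₂ B₂ A₁ B₁ →
                        β :* (u :* A₂ :+ v :* B₂) :+ α :* (u :* A₁ :+ v :* B₁)
                        := u :* (β :* A₂ :+ α :* A₁) :+ v :* (β :* B₂ :+ α :* B₁))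
                refl β α u v A₂ B₂ A₁ B₁ ⟩
        combination (suc n) proj₂                 ∎)
      where
      open ≡-Reasoning
      β = b (suc n)
      α = a (suc n)
      u = U 0
      v = U 1
      A₁ = proj₁ (numPair n)
      A₂ = proj₂ (numPair n)
      B₁ = proj₁ (denPair n)
      B₂ = proj₂ (denPair n)

  factorisation : ∀ U → Solution U → U 0 ≢ 0ℚ → ∀ n → denB a b n ≢ 0ℚ →
                  U (suc n) ≡ (U 0 * denB a b n) * (convergent a b n - (- (U 1 ÷₀ U 0)))
  factorisation U sol U₀≢0 n Bₙ≢0 = begin
    U (suc n)                ≡⟨ superposition U sol n ⟩
    U 0 * Aₙ + U 1 * Bₙ      ≡⟨ cong₂ (λ s t → U 0 * s + t * Bₙ)
                                  (sym (÷₀-*-inverse Aₙ Bₙ Bₙ≢0))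
                                  (sym (÷₀-*-inverse (U 1) (U 0) U₀≢0)) ⟩
    U 0 * (f * Bₙ) + (q * U 0) * Bₙ
      ≡⟨ solve 4 (λ u f B q → u :* (f :* B) :+ (q :* u) :* B := (u :* B) :* (f :- (:- q)))
           refl (U 0) f Bₙ q ⟩
    (U 0 * Bₙ) * (f - (- q)) ∎
    where
    open ≡-Reasoning
    Aₙ = numA a b n
    Bₙ = denB a b n
    f = convergent a b n
    q = U 1 ÷₀ U 0

  module Alternation (0≤a : ∀ n → 0ℚ ≤ a n) (b<0 : ∀ n → b n < 0ℚ) where

    EvenSigns OddSigns : ℕ → Set
    EvenSigns m = proj₁ (denPair m) ≤ 0ℚ × 0ℚ < proj₂ (denPair m)
    OddSigns m = 0ℚ ≤ proj₁ (denPair m) × proj₂ (denPair m) < 0ℚ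

    even→odd : ∀ m → EvenSigns m → OddSigns (suc m)
    even→odd m (x≤0 , 0<y) = <⇒≤ 0<y , step-neg (b<0 (suc m)) (0≤a (suc m)) 0<y x≤0

    odd→even : ∀ m → OddSigns m → EvenSigns (suc m)
    odd→even m (0≤x , y<0) = <⇒≤ y<0 , step-pos (b<0 (suc m)) (0≤a (suc m)) y<0 0≤x

    evenSigns : ∀ k → EvenSigns (k +ℕ k)
    evenSigns zero = ≤-refl , positive⁻¹ 1ℚ
    evenSigns (suc k) = subst EvenSigns (sym (+-suc (suc k) k)) (odd→even _ (even→odd _ (evenSigns k)))

    denB-even-pos : ∀ m → Even m → 0ℚ < denB a b m
    denB-even-pos .(k +ℕ k) (k , refl) = proj₂ (evenSigns k)

    denB-odd-neg : ∀ m → Odd m → denB a b m < 0ℚ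
    denB-odd-neg .(suc (k +ℕ k)) (k , refl) = proj₂ (even→odd _ (evenSigns k))

    sign-criterion : ∀ U → Solution U → 0ℚ < U 0 →
      let f = convergent a b
          c = - (U 1 ÷₀ U 0)
      in (∀ n → Even (suc n) → (0ℚ < U (suc (suc n)) ⇔ c < f (suc n)))
       × (∀ n → Odd (suc n) → (0ℚ < U (suc (suc n)) ⇔ f (suc n) < c))
    sign-criterion U sol 0<U₀ = even-case , odd-case
      where
      c = - (U 1 ÷₀ U 0)
      f = convergent a b

      even-case : ∀ n → Even (suc n) → (0ℚ < U (suc (suc n)) ⇔ c < f (suc n))
      even-case n ev = subst (λ t → 0ℚ < t ⇔ c < f (suc n))
        (sym (factorisation U sol (≢-sym (<⇒≢ 0<U₀)) (suc n) (≢-sym (<⇒≢ 0<B))))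
        (0<d*[y-x]⇔x<y (U 0 * Bₙ) c (f (suc n))
           (positive⁻¹ (U 0 * Bₙ) {{pos*pos⇒pos (U 0) {{positive 0<U₀}} Bₙ {{positive 0<B}}}}))
        where
        Bₙ = denB a b (suc n)
        0<B = denB-even-pos (suc n) ev

      odd-case : ∀ n → Odd (suc n) → (0ℚ < U (suc (suc n)) ⇔ f (suc n) < c)
      odd-case n od = subst (λ t → 0ℚ < t ⇔ f (suc n) < c)
        (sym (factorisation U sol (≢-sym (<⇒≢ 0<U₀)) (suc n) (<⇒≢ B<0)))
        (0<d*[y-x]⇔y<x (U 0 * Bₙ) c (f (suc n))
           (negative⁻¹ (U 0 * Bₙ) {{pos*neg⇒neg (U 0) {{positive 0<U₀}} Bₙ {{negative B<0}}}}))
        where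
        Bₙ = denB a b (suc n)
        B<0 = denB-odd-neg (suc n) od

lemma18 : (α₁ α₀ β₁ β₀ γ₁ γ₀ : ℚ) →
  ¬ (α₁ ≡ 0ℚ × α₀ ≡ 0ℚ) → ¬ (β₁ ≡ 0ℚ × β₀ ≡ 0ℚ) → ¬ (γ₁ ≡ 0ℚ × γ₀ ≡ 0ℚ) →
  (∀ n → lin α₁ α₀ n ≢ 0ℚ) → (∀ n → lin β₁ β₀ n ≢ 0ℚ) → (∀ n → lin γ₁ γ₀ n ≢ 0ℚ) →
  (∀ n → 0ℚ < lin α₁ α₀ n) → (∀ n → lin β₁ β₀ n < 0ℚ) → (∀ n → 0ℚ < lin γ₁ γ₀ n) →
  (U : ℕ → ℚ) →
  (∀ m → lin α₁ α₀ (suc m) * U (suc (suc m))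
         ≡ lin β₁ β₀ (suc m) * U (suc m) + lin γ₁ γ₀ (suc m) * U m) →
  0ℚ < U 0 →
  let b = λ n → lin β₁ β₀ n ÷₀ lin α₁ α₀ n
      a = λ n → lin γ₁ γ₀ n ÷₀ lin α₁ α₀ n
      f = convergent a b
      c = - (U 1 ÷₀ U 0)
  in (∀ n → Even (suc n) → (0ℚ < U (suc (suc n)) ⇔ c < f (suc n)))
   × (∀ n → Odd (suc n) → (0ℚ < U (suc (suc n)) ⇔ f (suc n) < c))
lemma18 α₁ α₀ β₁ β₀ γ₁ γ₀ _ _ _ g₃≢0 _ _ 0<g₃ g₂<0 0<g₁ U rec 0<U₀ =
  Alternation.sign-criterion 0≤a b<0 U solution 0<U₀
  where
  g₃ = lin α₁ α₀
  b = λ n → lin β₁ β₀ n ÷₀ g₃ n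
  a = λ n → lin γ₁ γ₀ n ÷₀ g₃ n
  open ContinuedFraction a b

  0≤a : ∀ n → 0ℚ ≤ a n
  0≤a n = <⇒≤ (÷₀-pos _ _ (0<g₁ n) (0<g₃ n))

  b<0 : ∀ n → b n < 0ℚ
  b<0 n = ÷₀-neg _ _ (g₂<0 n) (0<g₃ n)

  solution : Solution U
  solution m = normalise-recurrence _ _ _ (U m) (U (suc m)) (U (suc (suc m))) (g₃≢0 (suc m)) (rec m)
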